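{- Let $m$ be a positive integer with $m\equiv 5,8\pmod{12}$. Then $\Phi(m\times 2,3,1)\le J(m\times 2,3,1)-1$.
   Context: Let $I_m=\{0,1,\dots,m-1\}$ and $\mathbb{Z}_n$ the integers modulo $n$. A $2$-D $(m\times n,k,1)$-OOC is a set $\mathcal{C}$ of $k$-subsets of $I_m\times\mathbb{Z}_n$ such that $|A\cap(A+\tau)|\le 1$ for every $A\in\mathcal{C}$ and every integer $\tau\not\equiv 0\pmod n$, and $|A\cap(B+\tau)|\le 1$ for all distinct $A,B\in\mathcal{C}$ and every integer $\tau$, where $B+\tau=\{(i,x+\tau \bmod n):(i,x)\in B\}$. $\Phi(m\times n,k,1)$ denotes the largest possible number of codewords of such a code. $J(m\times n,3,1)=\left\lfloor \frac{m}{3}\left\lfloor\frac{mn-1}{2}\right\rfloor\right\rfloor$. -}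

module Defs where

open import Data.Nat using (ℕ; _+_; _*_; _∸_; _≤_; NonZero)
open import Data.Nat.DivMod using (_/_; _mod_)
open import Data.Fin using (Fin; toℕ)
open import Data.Bool using (Bool; _∧_; if_then_else_)
open import Data.List using (List; map; allFin; length; lookup)
open import Data.Nat.ListAction using (sum)
open import Relation.Binary.PropositionalEquality using (_≡_)
open import Relation.Nullary using (¬_)

-- A subset of I_m × Z_n, given by its characteristic function.
-- Z_n is represented by Fin n with arithmetic modulo n.
Subset2D : ℕ → ℕ → Set
Subset2D m n = Fin m → Fin n → Bool

card : ∀ {m n} → Subset2D m n → ℕ
card {m} {n} A =
  sum (map (λ i → sum (map (λ x → if A i x then 1 else 0) (allFin n))) (allFin m))

-- B + τ = {(i, x + τ mod n) : (i,x) ∈ B}; so (i,y) ∈ B + τ iff (i, y - τ mod n) ∈ B.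
-- Shifts τ are taken modulo n, i.e. τ ∈ Z_n.
shift : ∀ {m n} .{{_ : NonZero n}} → Fin n → Subset2D m n → Subset2D m n
shift {m} {n} τ B i y = B i ((toℕ y + (n ∸ toℕ τ)) mod n)

interCard : ∀ {m n} → Subset2D m n → Subset2D m n → ℕ
interCard A B = card (λ i x → A i x ∧ B i x)

-- Distinctness of the
-- codewords is expressed through distinct list positions: the cross
-- condition at τ = 0 forces entries at distinct positions to be distinct
-- k-subsets, so the list length is the number of codewords.
record IsOOC2D (m n k : ℕ) .{{_ : NonZero n}} (C : List (Subset2D m n)) : Set where
  field
    weight : ∀ p → card (lookup C p) ≡ k
    auto   : ∀ p (τ : Fin n) → ¬ (toℕ τ ≡ 0) →
             interCard (lookup C p) (shift τ (lookup C p)) ≤ 1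
    cross  : ∀ p q → ¬ (p ≡ q) → (τ : Fin n) →
             interCard (lookup C p) (shift τ (lookup C q)) ≤ 1

-- J(m×n,3,1) = ⌊ (m/3) ⌊(mn-1)/2⌋ ⌋ = ⌊ m ⌊(mn-1)/2⌋ / 3 ⌋
J : ℕ → ℕ → ℕ
J m n = (m * ((m * n ∸ 1) / 2)) / 3

{-# OPTIONS --safe #-}
module Submission where

-- A codeword A meets every row at most once (two points in one row would give |A ∩ (A + 1)| = 2),
-- so it is a triangle on three rows whose edges are labelled by column differences in ℤ₂.  The
-- correlation conditions say that no two codewords share a pair of rows with the same difference:
-- the code is a packing of the doubled complete graph 2Kₘ by triangles.  The uncovered edges form
-- the leave, in which every vertex has even degree.  For m ≡ 5, 8 (mod 12) we have
-- m(m − 1) = 3J + 2, so a code with J codewords leaves exactly two edges.  Each triangle covers 0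
-- or 2 edges of difference 1 while m(m − 1)/2 is even, so both leave edges have the same
-- difference and the leave is a simple graph; but a nonempty simple graph with even degrees has at
-- least three edges.

open import Defs
open import Data.Bool using (Bool; true; false; T; _∧_; if_then_else_)
open import Data.Bool.Properties using (T-∧)
open import Data.Empty using (⊥; ⊥-elim)
open import Data.Fin using (Fin; zero; suc; punchIn; _≟_)
open import Data.Fin.Patterns using (0F; 1F)
open import Data.Fin.Properties using (punchInᵢ≢i)
open import Data.List using (List; length; lookup; map; allFin; tabulate)
open import Data.List.Properties using (map-tabulate)
import Data.Nat.ListAction as List
open import Data.Nat using (ℕ; zero; suc; _+_; _*_; _∸_; _%_; _/_; _≤_; _<_; z≤n; s≤s; s≤s⁻¹; z<s)
open import Data.Nat.Properties hiding (_≟_)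
open import Data.Nat.Divisibility
  using (_∣_; divides; ∣⇒≤; ∣m∣n⇒∣m+n; ∣m+n∣m⇒∣n; m∣m*n; n∣m*n; m%n≡0⇒n∣m)
open import Data.Nat.DivMod
open import Data.Nat.Tactic.RingSolver using (solve-∀)
open import Data.Product using (∃; _×_; _,_; proj₁)
open import Data.Sum using (_⊎_; inj₁; inj₂)
open import Data.Vec.Functional using (removeAt)
open import Function using (_∘_; Equivalence)
open import Relation.Binary.PropositionalEquality
  using (_≡_; _≢_; refl; sym; trans; cong; cong₂; subst; module ≡-Reasoning)
open import Relation.Nullary using (yes; no)

open import Algebra.Properties.CommutativeSemigroup +-commutativeSemigroup
  using () renaming (interchange to +-interchange)
open import Algebra.Properties.Semiring.Sum +-*-semiring
  using (sum; sum-syntax; sum-cong-≗; sum-remove; ∑-distrib-+; ∑-comm; *-distribˡ-sum; *-distribʳ-sum)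

sum-const : ∀ n c → ∑[ i < n ] c ≡ n * c
sum-const zero    c = refl
sum-const (suc n) c = cong (c +_) (sum-const n c)

sum-*-sum : ∀ {k l} (f : Fin k → ℕ) (g : Fin l → ℕ) → sum f * sum g ≡ ∑[ i < k ] ∑[ j < l ] (f i * g j)
sum-*-sum f g = trans (*-distribʳ-sum (sum g) f) (sum-cong-≗ (λ i → *-distribˡ-sum (f i) g))

sum-mono-≤ : ∀ {n} {f g : Fin n → ℕ} → (∀ i → f i ≤ g i) → sum f ≤ sum g
sum-mono-≤ {zero}  _   = z≤n
sum-mono-≤ {suc n} f≤g = +-mono-≤ (f≤g zero) (sum-mono-≤ (f≤g ∘ suc))

term≤sum : ∀ {n} (f : Fin n → ℕ) i → f i ≤ sum f
term≤sum f zero    = m≤m+n (f zero) _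
term≤sum f (suc i) = ≤-trans (term≤sum (f ∘ suc) i) (m≤n+m _ (f zero))

two-terms≤sum : ∀ {n} (f : Fin n → ℕ) {i j} → i ≢ j → f i + f j ≤ sum f
two-terms≤sum f {zero}  {zero}  i≢j = ⊥-elim (i≢j refl)
two-terms≤sum f {zero}  {suc j} _   = +-monoʳ-≤ (f zero) (term≤sum (f ∘ suc) j)
two-terms≤sum f {suc i} {zero}  _   =
  ≤-trans (≤-reflexive (+-comm (f (suc i)) (f zero))) (+-monoʳ-≤ (f zero) (term≤sum (f ∘ suc) i))
two-terms≤sum f {suc i} {suc j} i≢j =
  ≤-trans (two-terms≤sum (f ∘ suc) (i≢j ∘ cong suc)) (m≤n+m _ (f zero))

sum≡0⇒≡0 : ∀ {n} (f : Fin n → ℕ) → sum f ≡ 0 → ∀ i → f i ≡ 0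
sum≡0⇒≡0 f Σf≡0 i = n≤0⇒n≡0 (subst (f i ≤_) Σf≡0 (term≤sum f i))

≡0⇒sum≡0 : ∀ {n} {f : Fin n → ℕ} → (∀ i → f i ≡ 0) → sum f ≡ 0
≡0⇒sum≡0 {n} f≡0 = trans (sum-cong-≗ f≡0) (trans (sum-const n 0) (*-zeroʳ n))

sum-positive : ∀ {n} (f : Fin n → ℕ) → 0 < sum f → ∃ λ i → 0 < f i
sum-positive {suc n} f 0<Σf with f zero in f₀≡
... | suc _ = zero , subst (0 <_) (sym f₀≡) z<s
... | zero  with sum-positive (f ∘ suc) 0<Σf
...   | i , 0<fᵢ = suc i , 0<fᵢ

at-most-one-positive⇒sum≤1 : ∀ {n} (f : Fin n → ℕ) → (∀ i → f i ≤ 1) →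
                              (∀ i j → i ≢ j → 0 < f i → 0 < f j → ⊥) → sum f ≤ 1
at-most-one-positive⇒sum≤1 {zero}  f _   _     = z≤n
at-most-one-positive⇒sum≤1 {suc n} f f≤1 apart with f zero in f₀≡
... | zero  = at-most-one-positive⇒sum≤1 (f ∘ suc) (f≤1 ∘ suc)
                (λ i j i≢j → apart (suc i) (suc j) λ { refl → i≢j refl })
... | suc k = subst (λ s → suc k + s ≤ 1) (sym (≡0⇒sum≡0 rest≡0))
                (subst (_≤ 1) (sym (+-identityʳ (suc k))) (subst (_≤ 1) f₀≡ (f≤1 zero)))
  where
  rest≡0 : ∀ j → f (suc j) ≡ 0
  rest≡0 j = n≤0⇒n≡0 (≮⇒≥ (apart zero (suc j) (λ ()) (subst (0 <_) (sym f₀≡) z<s)))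

∣-sum : ∀ {d n} (f : Fin n → ℕ) → (∀ i → d ∣ f i) → d ∣ sum f
∣-sum {n = zero}  f d∣f = divides 0 refl
∣-sum {n = suc n} f d∣f = ∣m∣n⇒∣m+n (d∣f zero) (∣-sum (f ∘ suc) (d∣f ∘ suc))

sum-remove-zero : ∀ {n} (v : Fin (suc n) → ℕ) {i} → v i ≡ 0 → sum v ≡ sum (removeAt v i)
sum-remove-zero v {i} vᵢ≡0 = trans (sum-remove v) (cong (_+ sum (removeAt v i)) vᵢ≡0)

sum-offDiagonal : ∀ {n} (v : Fin (suc n) → ℕ) i {c} →
                  v i ≡ 0 → (∀ j → i ≢ j → v j ≡ c) → sum v ≡ n * c
sum-offDiagonal {n} v i {c} vᵢ≡0 v≡c = begin
  sum v               ≡⟨ sum-remove-zero v vᵢ≡0 ⟩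
  sum (removeAt v i)  ≡⟨ sum-cong-≗ (λ k → v≡c (punchIn i k) (punchInᵢ≢i i k ∘ sym)) ⟩
  ∑[ k < n ] c        ≡⟨ sum-const n c ⟩
  n * c               ∎
  where open ≡-Reasoning

sum-removeAt-products : ∀ {n} (r : Fin (suc n) → ℕ) i → r i ≤ 1 → sum r ≡ 3 →
                        sum (removeAt (λ j → r i * r j) i) ≡ 2 * r i
sum-removeAt-products r i rᵢ≤1 Σr≡3 = cancel rᵢ≤1 (begin
  r i * 3                                         ≡⟨ cong (r i *_) Σr≡3 ⟨
  r i * sum r                                     ≡⟨ *-distribˡ-sum (r i) r ⟩
  ∑[ j < _ ] (r i * r j)                          ≡⟨ sum-remove (λ j → r i * r j) ⟩
  r i * r i + sum (removeAt (λ j → r i * r j) i)  ∎)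
  where
  open ≡-Reasoning
  cancel : ∀ {x s} → x ≤ 1 → x * 3 ≡ x * x + s → s ≡ 2 * x
  cancel {zero}        _        eq = sym eq
  cancel {suc zero}    _        eq = sym (suc-injective eq)
  cancel {suc (suc _)} (s≤s ()) _

double≤even : ∀ {x y} → x ≤ 1 → x ≤ y → 2 ∣ y → 2 * x ≤ y
double≤even {zero}             _        _  _   = z≤n
double≤even {suc zero} {suc y} _        _  2∣y = ∣⇒≤ 2∣y
double≤even {suc (suc _)}      (s≤s ()) _  _

even<2⇒≡0 : ∀ {y} → 2 ∣ y → y < 2 → y ≡ 0
even<2⇒≡0 {zero}  _   _   = refl
even<2⇒≡0 {suc y} 2∣y y<2 = ⊥-elim (1+n≰n (≤-trans (∣⇒≤ 2∣y) (s≤s⁻¹ y<2)))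

m+n≡4⇒4∣n⇒m≡0⊎n≡0 : ∀ {x y} → x + y ≡ 4 → 4 ∣ y → x ≡ 0 ⊎ y ≡ 0
m+n≡4⇒4∣n⇒m≡0⊎n≡0 {x} {zero}  _  _   = inj₂ refl
m+n≡4⇒4∣n⇒m≡0⊎n≡0 {x} {suc y} eq 4∣y =
  inj₁ (n≤0⇒n≡0 (+-cancelʳ-≤ 4 x 0 (≤-trans (+-monoʳ-≤ x (∣⇒≤ 4∣y)) (≤-reflexive eq))))

-- The trailing + 0 is how a sum over Fin 2 unfolds.
m+n≡3⇒4∣m*n+n*m : ∀ a b → a + b ≡ 3 → 4 ∣ a * b + (b * a + 0)
m+n≡3⇒4∣m*n+n*m 0 .3 refl = divides 0 refl
m+n≡3⇒4∣m*n+n*m 1 .2 refl = divides 1 refl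
m+n≡3⇒4∣m*n+n*m 2 .1 refl = divides 1 refl
m+n≡3⇒4∣m*n+n*m 3 .0 refl = divides 0 refl

module EvenSimpleGraph {n : ℕ} (E : Fin (suc n) → Fin (suc n) → ℕ)
  (E-sym : ∀ i j → E i j ≡ E j i) (E-loopless : ∀ i → E i i ≡ 0) (E≤1 : ∀ i j → E i j ≤ 1)
  (degree-even : ∀ i → 2 ∣ sum (E i)) where

  degree : Fin (suc n) → ℕ
  degree i = sum (E i)

  3*degree≤totalDegree : ∀ a → 3 * degree a ≤ sum degree
  3*degree≤totalDegree a = begin
    3 * degree a
      ≡⟨⟩
    degree a + 2 * degree a
      ≡⟨ cong (λ d → degree a + 2 * d) degree≡offDiagonal ⟩
    degree a + 2 * sum (removeAt (E a) a)
      ≡⟨ cong (degree a +_) (*-distribˡ-sum 2 (removeAt (E a) a)) ⟩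
    degree a + ∑[ k < n ] (2 * E a (punchIn a k))
      ≤⟨ +-monoʳ-≤ (degree a) (sum-mono-≤ (2*edge≤degree ∘ punchIn a)) ⟩
    degree a + sum (removeAt degree a)
      ≡⟨ sum-remove degree ⟨
    sum degree
      ∎
    where
    open ≤-Reasoning
    degree≡offDiagonal : degree a ≡ sum (removeAt (E a) a)
    degree≡offDiagonal = sum-remove-zero (E a) (E-loopless a)
    2*edge≤degree : ∀ j → 2 * E a j ≤ degree j
    2*edge≤degree j =
      double≤even (E≤1 a j) (subst (_≤ degree j) (E-sym j a) (term≤sum (E j) a)) (degree-even j)

  totalDegree<6⇒≡0 : sum degree < 6 → sum degree ≡ 0
  totalDegree<6⇒≡0 total<6 = ≡0⇒sum≡0 (λ a → even<2⇒≡0 (degree-even a)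
    (*-cancelˡ-< 3 (degree a) 2 (≤-<-trans (3*degree≤totalDegree a) total<6)))

⟦_⟧ : Bool → ℕ
⟦ b ⟧ = if b then 1 else 0

⟦⟧≤1 : ∀ b → ⟦ b ⟧ ≤ 1
⟦⟧≤1 true  = s≤s z≤n
⟦⟧≤1 false = z≤n

T⇒⟦⟧≡1 : ∀ {b} → T b → ⟦ b ⟧ ≡ 1
T⇒⟦⟧≡1 {true} _ = refl

rowCount : ∀ {m n} → Subset2D m n → Fin m → ℕ
rowCount {n = n} A i = ∑[ x < n ] ⟦ A i x ⟧

listSum-allFin : ∀ {k} (f : Fin k → ℕ) → List.sum (map f (allFin k)) ≡ sum f
listSum-allFin f = trans (cong List.sum (map-tabulate (λ i → i) f)) (listSum-tabulate f)
  where
  listSum-tabulate : ∀ {k} (f : Fin k → ℕ) → List.sum (tabulate f) ≡ sum f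
  listSum-tabulate {zero}  f = refl
  listSum-tabulate {suc k} f = cong (f zero +_) (listSum-tabulate (f ∘ suc))

card≡∑rowCount : ∀ {m n} (A : Subset2D m n) → card A ≡ ∑[ i < m ] rowCount A i
card≡∑rowCount {m} {n} A =
  trans (listSum-allFin (λ i → List.sum (map (λ x → ⟦ A i x ⟧) (allFin n))))
        (sum-cong-≗ (λ i → listSum-allFin (λ x → ⟦ A i x ⟧)))

point≤rowCount : ∀ {m n} (A : Subset2D m n) {i x} → T (A i x) → 1 ≤ rowCount A i
point≤rowCount A {i} {x} Aix = subst (_≤ rowCount A i) (T⇒⟦⟧≡1 Aix) (term≤sum (λ z → ⟦ A i z ⟧) x)

two-points⇒2≤card : ∀ {m n} (A : Subset2D m n) {i j x y} → (i , x) ≢ (j , y) →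
                     T (A i x) → T (A j y) → 2 ≤ card A
two-points⇒2≤card A {i} {j} {x} {y} ix≢jy Aix Ajy rewrite card≡∑rowCount A with i ≟ j
... | no i≢j   = ≤-trans (+-mono-≤ (point≤rowCount A Aix) (point≤rowCount A Ajy))
                         (two-terms≤sum (rowCount A) i≢j)
... | yes refl = ≤-trans (subst (_≤ rowCount A i) (cong₂ _+_ (T⇒⟦⟧≡1 Aix) (T⇒⟦⟧≡1 Ajy))
                                 (two-terms≤sum (λ z → ⟦ A i z ⟧) (ix≢jy ∘ cong (i ,_))))
                         (term≤sum (rowCount A) i)

two-common-points⇒2≤interCard : ∀ {m n} (A B : Subset2D m n) {i j x y} → (i , x) ≢ (j , y) →
                                 T (A i x) → T (B i x) → T (A j y) → T (B j y) → 2 ≤ interCard A B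
two-common-points⇒2≤interCard A B ix≢jy Aix Bix Ajy Bjy =
  two-points⇒2≤card (λ k z → A k z ∧ B k z) ix≢jy (T-∧-intro Aix Bix) (T-∧-intro Ajy Bjy)
  where
  T-∧-intro : ∀ {a b} → T a → T b → T (a ∧ b)
  T-∧-intro p q = Equivalence.from T-∧ (p , q)

_⊕_ : Fin 2 → Fin 2 → Fin 2
0F ⊕ y  = y
1F ⊕ 0F = 1F
1F ⊕ 1F = 0F

shift-⊕ : ∀ {m} (B : Subset2D m 2) i x y → shift (x ⊕ y) B i x ≡ B i y
shift-⊕ B i 0F 0F = refl
shift-⊕ B i 0F 1F = refl
shift-⊕ B i 1F 0F = refl
shift-⊕ B i 1F 1F = refl

⊕-cancelʳ : ∀ x y β → (x ⊕ β) ⊕ (y ⊕ β) ≡ x ⊕ y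
⊕-cancelʳ 0F 0F 0F = refl
⊕-cancelʳ 0F 0F 1F = refl
⊕-cancelʳ 0F 1F 0F = refl
⊕-cancelʳ 0F 1F 1F = refl
⊕-cancelʳ 1F 0F 0F = refl
⊕-cancelʳ 1F 0F 1F = refl
⊕-cancelʳ 1F 1F 0F = refl
⊕-cancelʳ 1F 1F 1F = refl

pairCount : ∀ {m} → Fin 2 → Subset2D m 2 → Fin m → Fin m → ℕ
pairCount β A i j = ∑[ x < 2 ] (⟦ A i x ⟧ * ⟦ A j (x ⊕ β) ⟧)

columnCount : ∀ {m} → Subset2D m 2 → Fin 2 → ℕ
columnCount {m} A x = ∑[ i < m ] ⟦ A i x ⟧

module _ {m : ℕ} (A : Subset2D m 2) where

  pairCount-sym : ∀ β i j → pairCount β A i j ≡ pairCount β A j i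
  pairCount-sym 0F i j = swap ⟦ A i 0F ⟧ ⟦ A i 1F ⟧ ⟦ A j 0F ⟧ ⟦ A j 1F ⟧
    where
    swap : ∀ a₀ a₁ b₀ b₁ → a₀ * b₀ + (a₁ * b₁ + 0) ≡ b₀ * a₀ + (b₁ * a₁ + 0)
    swap = solve-∀
  pairCount-sym 1F i j = swap ⟦ A i 0F ⟧ ⟦ A i 1F ⟧ ⟦ A j 0F ⟧ ⟦ A j 1F ⟧
    where
    swap : ∀ a₀ a₁ b₀ b₁ → a₀ * b₁ + (a₁ * b₀ + 0) ≡ b₀ * a₁ + (b₁ * a₀ + 0)
    swap = solve-∀

  pairCount-split : ∀ i j → pairCount 0F A i j + pairCount 1F A i j ≡ rowCount A i * rowCount A j
  pairCount-split i j = expand ⟦ A i 0F ⟧ ⟦ A i 1F ⟧ ⟦ A j 0F ⟧ ⟦ A j 1F ⟧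
    where
    expand : ∀ a₀ a₁ b₀ b₁ → a₀ * b₀ + (a₁ * b₁ + 0) + (a₀ * b₁ + (a₁ * b₀ + 0)) ≡
                             (a₀ + (a₁ + 0)) * (b₀ + (b₁ + 0))
    expand = solve-∀

  pairCount≤rowCount : ∀ β i j → pairCount β A i j ≤ rowCount A i
  pairCount≤rowCount β i j = sum-mono-≤ {g = λ x → ⟦ A i x ⟧}
    (λ x → ≤-trans (*-monoʳ-≤ ⟦ A i x ⟧ (⟦⟧≤1 (A j (x ⊕ β)))) (≤-reflexive (*-identityʳ ⟦ A i x ⟧)))

  pairCount-positive : ∀ β i j → 0 < pairCount β A i j → ∃ λ x → T (A i x) × T (A j (x ⊕ β))
  pairCount-positive β i j 0<pairs with sum-positive _ 0<pairs
  ... | x , 0<term = x , both (A i x) (A j (x ⊕ β)) 0<term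
    where
    both : ∀ a b → 0 < ⟦ a ⟧ * ⟦ b ⟧ → T a × T b
    both true true _ = _ , _

  pairCount₁-diag : ∀ i → rowCount A i ≤ 1 → pairCount 1F A i i ≡ 0
  pairCount₁-diag i = vanish (A i 0F) (A i 1F)
    where
    vanish : ∀ a b → ⟦ a ⟧ + (⟦ b ⟧ + 0) ≤ 1 → ⟦ a ⟧ * ⟦ b ⟧ + (⟦ b ⟧ * ⟦ a ⟧ + 0) ≡ 0
    vanish true  true  (s≤s ())
    vanish true  false _ = refl
    vanish false true  _ = refl
    vanish false false _ = refl

  ∑∑pairCount : ∀ β → ∑[ i < m ] ∑[ j < m ] pairCount β A i j ≡
                      ∑[ x < 2 ] (columnCount A x * columnCount A (x ⊕ β))
  ∑∑pairCount β = begin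
    ∑[ i < m ] ∑[ j < m ] ∑[ x < 2 ] (⟦ A i x ⟧ * ⟦ A j (x ⊕ β) ⟧)
      ≡⟨ sum-cong-≗ (λ i → ∑-comm (λ j x → ⟦ A i x ⟧ * ⟦ A j (x ⊕ β) ⟧)) ⟩
    ∑[ i < m ] ∑[ x < 2 ] ∑[ j < m ] (⟦ A i x ⟧ * ⟦ A j (x ⊕ β) ⟧)
      ≡⟨ ∑-comm (λ i x → ∑[ j < m ] (⟦ A i x ⟧ * ⟦ A j (x ⊕ β) ⟧)) ⟩
    ∑[ x < 2 ] ∑[ i < m ] ∑[ j < m ] (⟦ A i x ⟧ * ⟦ A j (x ⊕ β) ⟧)
      ≡⟨ sum-cong-≗ (λ x → sum-*-sum (λ i → ⟦ A i x ⟧) (λ j → ⟦ A j (x ⊕ β) ⟧)) ⟨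
    ∑[ x < 2 ] (columnCount A x * columnCount A (x ⊕ β))
      ∎
    where open ≡-Reasoning

  4∣∑∑pairCount₁ : card A ≡ 3 → 4 ∣ ∑[ i < m ] ∑[ j < m ] pairCount 1F A i j
  4∣∑∑pairCount₁ card≡3 = subst (4 ∣_) (sym (∑∑pairCount 1F))
    (m+n≡3⇒4∣m*n+n*m (columnCount A 0F) (columnCount A 1F) (begin
      columnCount A 0F + columnCount A 1F  ≡⟨ cong (columnCount A 0F +_) (+-identityʳ _) ⟨
      ∑[ x < 2 ] columnCount A x           ≡⟨ ∑-comm (λ i x → ⟦ A i x ⟧) ⟨
      ∑[ i < m ] rowCount A i              ≡⟨ card≡∑rowCount A ⟨
      card A                               ≡⟨ card≡3 ⟩
      3                                    ∎))
    where open ≡-Reasoning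

  rowCount≤1 : interCard A (shift 1F A) ≤ 1 → ∀ i → rowCount A i ≤ 1
  rowCount≤1 auto i = at-most-one (A i 0F) (A i 1F) (λ p q → 1+n≰n (≤-trans (both-points p q) auto))
    where
    both-points : T (A i 0F) → T (A i 1F) → 2 ≤ interCard A (shift 1F A)
    both-points p q = two-common-points⇒2≤interCard A (shift 1F A) {i} {i} {0F} {1F} (λ ()) p q q p
    at-most-one : ∀ a b → (T a → T b → ⊥) → ⟦ a ⟧ + (⟦ b ⟧ + 0) ≤ 1
    at-most-one true  true  ¬both = ⊥-elim (¬both _ _)
    at-most-one true  false _     = s≤s z≤n
    at-most-one false true  _     = s≤s z≤n
    at-most-one false false _     = z≤n

no-common-difference : ∀ {m} (A B : Subset2D m 2) → (∀ τ → interCard A (shift τ B) ≤ 1) →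
                       ∀ β {i j} → i ≢ j → 0 < pairCount β A i j → 0 < pairCount β B i j → ⊥
no-common-difference A B cross β {i} {j} i≢j 0<pairsA 0<pairsB
  with pairCount-positive A β i j 0<pairsA | pairCount-positive B β i j 0<pairsB
... | x , Aix , Ajx⊕β | y , Biy , Bjy⊕β = 1+n≰n (≤-trans common (cross (x ⊕ y)))
  where
  -- The shift x ⊕ y carries the points (i, y), (j, y ⊕ β) of B onto the points (i, x), (j, x ⊕ β) of A.
  B+τ-at-j : shift (x ⊕ y) B j (x ⊕ β) ≡ B j (y ⊕ β)
  B+τ-at-j = trans (cong (λ τ → shift τ B j (x ⊕ β)) (sym (⊕-cancelʳ x y β)))
                   (shift-⊕ B j (x ⊕ β) (y ⊕ β))
  common : 2 ≤ interCard A (shift (x ⊕ y) B)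
  common = two-common-points⇒2≤interCard A (shift (x ⊕ y) B) (i≢j ∘ cong proj₁)
             Aix (subst T (sym (shift-⊕ B i x y)) Biy) Ajx⊕β (subst T (sym B+τ-at-j) Bjy⊕β)

module Leave {t : ℕ} (C : List (Subset2D (suc t) 2)) (ooc : IsOOC2D (suc t) 2 3 C) where
  open IsOOC2D ooc

  private
    m N : ℕ
    m = suc t
    N = length C

  A : Fin N → Subset2D m 2
  A = lookup C

  rowCount-A≤1 : ∀ p i → rowCount (A p) i ≤ 1
  rowCount-A≤1 p = rowCount≤1 (A p) (auto p 1F (λ ()))

  ∑rowCount-A : ∀ p → sum (rowCount (A p)) ≡ 3
  ∑rowCount-A p = trans (sym (card≡∑rowCount (A p))) (weight p)

  -- Pairs of rows are ordered, so every edge of 2Kₘ is counted twice in the totals below: a leave of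
  -- two edges has total degree 4, and the difference-1 count 2 · #edges is a multiple of 4.
  covered : Fin 2 → Fin m → Fin m → ℕ
  covered β i j = ∑[ p < N ] pairCount β (A p) i j

  covered-sym : ∀ β i j → covered β i j ≡ covered β j i
  covered-sym β i j = sum-cong-≗ (λ p → pairCount-sym (A p) β i j)

  covered≤1 : ∀ β {i j} → i ≢ j → covered β i j ≤ 1
  covered≤1 β {i} {j} i≢j = at-most-one-positive⇒sum≤1 _
    (λ p → ≤-trans (pairCount≤rowCount (A p) β i j) (rowCount-A≤1 p i))
    (λ p q p≢q → no-common-difference (A p) (A q) (cross p q p≢q) β i≢j)

  covered₁-diag : ∀ i → covered 1F i i ≡ 0
  covered₁-diag i = ≡0⇒sum≡0 (λ p → pairCount₁-diag (A p) i (rowCount-A≤1 p i))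

  leave : Fin 2 → Fin m → Fin m → ℕ
  leave β i j with i ≟ j
  ... | yes _ = 0
  ... | no  _ = 1 ∸ covered β i j

  leave-diag : ∀ β i → leave β i i ≡ 0
  leave-diag β i with i ≟ i
  ... | yes _  = refl
  ... | no i≢i = ⊥-elim (i≢i refl)

  leave≤1 : ∀ β i j → leave β i j ≤ 1
  leave≤1 β i j with i ≟ j
  ... | yes _ = z≤n
  ... | no  _ = m∸n≤m 1 (covered β i j)

  leave-sym : ∀ β i j → leave β i j ≡ leave β j i
  leave-sym β i j with i ≟ j | j ≟ i
  ... | yes _   | yes _   = refl
  ... | yes i≡j | no  j≢i = ⊥-elim (j≢i (sym i≡j))
  ... | no  i≢j | yes j≡i = ⊥-elim (i≢j (sym j≡i))
  ... | no  _   | no  _   = cong (1 ∸_) (covered-sym β i j)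

  covered+leave : ∀ β {i j} → i ≢ j → covered β i j + leave β i j ≡ 1
  covered+leave β {i} {j} i≢j with i ≟ j
  ... | yes i≡j = ⊥-elim (i≢j i≡j)
  ... | no  _   = m+[n∸m]≡n (covered≤1 β i≢j)

  L : Fin m → Fin m → ℕ
  L i j = leave 0F i j + leave 1F i j

  L-sym : ∀ i j → L i j ≡ L j i
  L-sym i j = cong₂ _+_ (leave-sym 0F i j) (leave-sym 1F i j)

  L-loopless : ∀ i → L i i ≡ 0
  L-loopless i = cong₂ _+_ (leave-diag 0F i) (leave-diag 1F i)

  degree : Fin m → ℕ
  degree i = sum (L i)

  coverage : Fin m → Fin m → ℕ
  coverage i j = covered 0F i j + covered 1F i j

  coverage+L : ∀ {i j} → i ≢ j → coverage i j + L i j ≡ 2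
  coverage+L {i} {j} i≢j =
    trans (+-interchange (covered 0F i j) (covered 1F i j) (leave 0F i j) (leave 1F i j))
          (cong₂ _+_ (covered+leave 0F i≢j) (covered+leave 1F i≢j))

  usage : Fin m → ℕ
  usage i = ∑[ p < N ] rowCount (A p) i

  2*usage≡∑coverage-removeAt : ∀ i → 2 * usage i ≡ sum (removeAt (coverage i) i)
  2*usage≡∑coverage-removeAt i = begin
    2 * usage i
      ≡⟨ *-distribˡ-sum 2 (λ p → rowCount (A p) i) ⟩
    ∑[ p < N ] (2 * rowCount (A p) i)
      ≡⟨ sum-cong-≗ (λ p → sum-removeAt-products (rowCount (A p)) i (rowCount-A≤1 p i) (∑rowCount-A p)) ⟨
    ∑[ p < N ] ∑[ k < t ] (rowCount (A p) i * rowCount (A p) (punchIn i k))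
      ≡⟨ sum-cong-≗ (λ p → sum-cong-≗ (λ k → pairCount-split (A p) i (punchIn i k))) ⟨
    ∑[ p < N ] ∑[ k < t ] (pairs₀ p k + pairs₁ p k)
      ≡⟨ ∑-comm (λ p k → pairs₀ p k + pairs₁ p k) ⟩
    ∑[ k < t ] ∑[ p < N ] (pairs₀ p k + pairs₁ p k)
      ≡⟨ sum-cong-≗ (λ k → ∑-distrib-+ (λ p → pairs₀ p k) (λ p → pairs₁ p k)) ⟩
    sum (removeAt (coverage i) i)
      ∎
    where
    open ≡-Reasoning
    pairs₀ pairs₁ : Fin N → Fin t → ℕ
    pairs₀ p k = pairCount 0F (A p) i (punchIn i k)
    pairs₁ p k = pairCount 1F (A p) i (punchIn i k)

  2*usage+degree : ∀ i → 2 * usage i + degree i ≡ 2 * t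
  2*usage+degree i = begin
    2 * usage i + degree i
      ≡⟨ cong₂ _+_ (2*usage≡∑coverage-removeAt i) (sum-remove-zero (L i) (L-loopless i)) ⟩
    sum (removeAt (coverage i) i) + sum (removeAt (L i) i)
      ≡⟨ ∑-distrib-+ (removeAt (coverage i) i) (removeAt (L i) i) ⟨
    ∑[ k < t ] (coverage i (punchIn i k) + L i (punchIn i k))
      ≡⟨ sum-cong-≗ (λ k → coverage+L (punchInᵢ≢i i k ∘ sym)) ⟩
    ∑[ k < t ] 2
      ≡⟨ sum-const t 2 ⟩
    t * 2
      ≡⟨ *-comm t 2 ⟩
    2 * t
      ∎
    where open ≡-Reasoning

  degree-even : ∀ i → 2 ∣ degree i
  degree-even i = ∣m+n∣m⇒∣n (subst (2 ∣_) (sym (2*usage+degree i)) (m∣m*n t)) (m∣m*n (usage i))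

  ∑usage : sum usage ≡ N * 3
  ∑usage = trans (∑-comm (λ i p → rowCount (A p) i)) (trans (sum-cong-≗ ∑rowCount-A) (sum-const N 3))

  handshake : 2 * (N * 3) + sum degree ≡ 2 * (m * t)
  handshake = begin
    2 * (N * 3) + sum degree               ≡⟨ cong (λ u → 2 * u + sum degree) ∑usage ⟨
    2 * sum usage + sum degree             ≡⟨ cong (_+ sum degree) (*-distribˡ-sum 2 usage) ⟩
    ∑[ i < m ] (2 * usage i) + sum degree  ≡⟨ ∑-distrib-+ (λ i → 2 * usage i) degree ⟨
    ∑[ i < m ] (2 * usage i + degree i)    ≡⟨ sum-cong-≗ 2*usage+degree ⟩
    ∑[ i < m ] (2 * t)                     ≡⟨ *-distribˡ-sum {m} 2 (λ _ → t) ⟨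
    2 * ∑[ i < m ] t                       ≡⟨ cong (2 *_) (sum-const m t) ⟩
    2 * (m * t)                            ∎
    where open ≡-Reasoning

  packing-bound : N * 3 ≤ m * t
  packing-bound = *-cancelˡ-≤ 2 (≤-trans (m≤m+n (2 * (N * 3)) (sum degree)) (≤-reflexive handshake))

  ∑covered₁+∑leave₁ : ∑[ i < m ] sum (covered 1F i) + ∑[ i < m ] sum (leave 1F i) ≡ m * t
  ∑covered₁+∑leave₁ = begin
    ∑[ i < m ] sum (covered 1F i) + ∑[ i < m ] sum (leave 1F i)
      ≡⟨ ∑-distrib-+ (λ i → sum (covered 1F i)) (λ i → sum (leave 1F i)) ⟨
    ∑[ i < m ] (sum (covered 1F i) + sum (leave 1F i))
      ≡⟨ sum-cong-≗ row ⟩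
    ∑[ i < m ] t
      ≡⟨ sum-const m t ⟩
    m * t
      ∎
    where
    open ≡-Reasoning
    row : ∀ i → sum (covered 1F i) + sum (leave 1F i) ≡ t
    row i = begin
      sum (covered 1F i) + sum (leave 1F i)       ≡⟨ ∑-distrib-+ (covered 1F i) (leave 1F i) ⟨
      ∑[ j < m ] (covered 1F i j + leave 1F i j)  ≡⟨ sum-offDiagonal _ i diag (λ j → covered+leave 1F) ⟩
      t * 1                                       ≡⟨ *-identityʳ t ⟩
      t                                           ∎
      where
      diag : covered 1F i i + leave 1F i i ≡ 0
      diag = cong₂ _+_ (covered₁-diag i) (leave-diag 1F i)

  4∣∑covered₁ : 4 ∣ ∑[ i < m ] sum (covered 1F i)
  4∣∑covered₁ = subst (4 ∣_) (sym reorder) (∣-sum _ (λ p → 4∣∑∑pairCount₁ (A p) (weight p)))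
    where
    reorder : ∑[ i < m ] sum (covered 1F i) ≡ ∑[ p < N ] ∑[ i < m ] ∑[ j < m ] pairCount 1F (A p) i j
    reorder = trans (sum-cong-≗ (λ i → ∑-comm (λ j p → pairCount 1F (A p) i j)))
                    (∑-comm (λ i p → ∑[ j < m ] pairCount 1F (A p) i j))

  4∣∑leave₁ : 4 ∣ m * t → 4 ∣ ∑[ i < m ] sum (leave 1F i)
  4∣∑leave₁ 4∣mt = ∣m+n∣m⇒∣n (subst (4 ∣_) (sym ∑covered₁+∑leave₁) 4∣mt) 4∣∑covered₁

  ∑degree≡∑leave₀+∑leave₁ : sum degree ≡ ∑[ i < m ] sum (leave 0F i) + ∑[ i < m ] sum (leave 1F i)
  ∑degree≡∑leave₀+∑leave₁ = trans (sum-cong-≗ (λ i → ∑-distrib-+ (leave 0F i) (leave 1F i)))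
                                  (∑-distrib-+ (λ i → sum (leave 0F i)) (λ i → sum (leave 1F i)))

  leave-vanishes : ∀ β → ∑[ i < m ] sum (leave β i) ≡ 0 → ∀ i j → leave β i j ≡ 0
  leave-vanishes β ∑≡0 i j = sum≡0⇒≡0 (leave β i) (sum≡0⇒≡0 (λ i → sum (leave β i)) ∑≡0 i) j

  near-perfect⇒∑degree≡4 : 2 + N * 3 ≡ m * t → sum degree ≡ 4
  near-perfect⇒∑degree≡4 tight = +-cancelˡ-≡ (2 * (N * 3)) (sum degree) 4 (begin
    2 * (N * 3) + sum degree  ≡⟨ handshake ⟩
    2 * (m * t)               ≡⟨ cong (2 *_) tight ⟨
    2 * (2 + N * 3)           ≡⟨ *-distribˡ-+ 2 2 (N * 3) ⟩
    4 + 2 * (N * 3)           ≡⟨ +-comm 4 (2 * (N * 3)) ⟩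
    2 * (N * 3) + 4           ∎)
    where open ≡-Reasoning

  ∑degree≡4⇒L≤1 : 4 ∣ m * t → sum degree ≡ 4 → ∀ i j → L i j ≤ 1
  ∑degree≡4⇒L≤1 4∣mt ∑degree≡4
    with m+n≡4⇒4∣n⇒m≡0⊎n≡0 (trans (sym ∑degree≡∑leave₀+∑leave₁) ∑degree≡4) (4∣∑leave₁ 4∣mt)
  ... | inj₁ ∑leave₀≡0 = λ i j →
    subst (λ l → l + leave 1F i j ≤ 1) (sym (leave-vanishes 0F ∑leave₀≡0 i j)) (leave≤1 1F i j)
  ... | inj₂ ∑leave₁≡0 = λ i j →
    subst (λ l → leave 0F i j + l ≤ 1) (sym (leave-vanishes 1F ∑leave₁≡0 i j))
          (subst (_≤ 1) (sym (+-identityʳ (leave 0F i j))) (leave≤1 0F i j))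

  no-near-perfect-packing : 4 ∣ m * t → 2 + N * 3 ≢ m * t
  no-near-perfect-packing 4∣mt tight = 4≢0 (trans (sym ∑degree≡4) (totalDegree<6⇒≡0 ∑degree<6))
    where
    4≢0 : 4 ≢ 0
    4≢0 ()
    ∑degree≡4 : sum degree ≡ 4
    ∑degree≡4 = near-perfect⇒∑degree≡4 tight
    ∑degree<6 : sum degree < 6
    ∑degree<6 = subst (_< 6) (sym ∑degree≡4) (s≤s (s≤s (s≤s (s≤s (s≤s z≤n)))))
    open EvenSimpleGraph L L-sym L-loopless (∑degree≡4⇒L≤1 4∣mt ∑degree≡4) degree-even
      using (totalDegree<6⇒≡0)

m[m∸1]%12≡r[r∸1]%12 : ∀ t r → suc t % 12 ≡ suc r → suc t * t % 12 ≡ suc r * r % 12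
m[m∸1]%12≡r[r∸1]%12 t r m%12≡ = begin
  suc t * t % 12                                    ≡⟨ cong (λ s → suc s * s % 12) t≡r+k*12 ⟩
  (suc r + k * 12) * (r + k * 12) % 12              ≡⟨ %-distribˡ-* (suc r + k * 12) (r + k * 12) 12 ⟩
  (suc r + k * 12) % 12 * ((r + k * 12) % 12) % 12  ≡⟨ cong₂ (λ a b → a * b % 12)
                                                             ([m+kn]%n≡m%n (suc r) k 12)
                                                             ([m+kn]%n≡m%n r k 12) ⟩
  suc r % 12 * (r % 12) % 12                        ≡⟨ %-distribˡ-* (suc r) r 12 ⟨
  suc r * r % 12                                    ∎
  where
  open ≡-Reasoning
  k : ℕ
  k = suc t / 12
  t≡r+k*12 : t ≡ r + k * 12
  t≡r+k*12 = suc-injective (trans (m≡m%n+[m/n]*n (suc t) 12) (cong (_+ k * 12) m%12≡))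

m[m∸1]%12≡8 : ∀ t → suc t % 12 ≡ 5 ⊎ suc t % 12 ≡ 8 → suc t * t % 12 ≡ 8
m[m∸1]%12≡8 t (inj₁ m%12≡5) = m[m∸1]%12≡r[r∸1]%12 t 4 m%12≡5
m[m∸1]%12≡8 t (inj₂ m%12≡8) = m[m∸1]%12≡r[r∸1]%12 t 7 m%12≡8

%12≡8⇒%3≡2 : ∀ x → x % 12 ≡ 8 → x % 3 ≡ 2
%12≡8⇒%3≡2 x x%12≡8 = trans (sym (m∣n⇒o%n%m≡o%m 3 12 x (divides 4 refl))) (cong (_% 3) x%12≡8)

%12≡8⇒4∣ : ∀ x → x % 12 ≡ 8 → 4 ∣ x
%12≡8⇒4∣ x x%12≡8 =
  m%n≡0⇒n∣m x 4 (trans (sym (m∣n⇒o%n%m≡o%m 4 12 x (divides 3 refl))) (cong (_% 4) x%12≡8))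

J≡m[m∸1]/3 : ∀ t → J (suc t) 2 ≡ suc t * t / 3
J≡m[m∸1]/3 t = cong (λ h → suc t * h / 3) (trans (+-distrib-/-∣ʳ 1 {d = 2} (n∣m*n t)) (m*n/n≡m t 2))

lemma3p2 : (m : ℕ) → (m % 12 ≡ 5 ⊎ m % 12 ≡ 8) →
    (C : List (Subset2D m 2)) → IsOOC2D m 2 3 C →
      length C ≤ J m 2 ∸ 1
lemma3p2 zero (inj₁ ())
lemma3p2 zero (inj₂ ())
lemma3p2 (suc t) m%12≡5,8 C ooc rewrite J≡m[m∸1]/3 t = ∸-monoˡ-≤ 1 (≤∧≢⇒< N≤Q N≢Q)
  where
  open Leave C ooc using (packing-bound; no-near-perfect-packing)
  x N : ℕ
  x = suc t * t
  N = length C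
  x%12≡8 : x % 12 ≡ 8
  x%12≡8 = m[m∸1]%12≡8 t m%12≡5,8
  N≤Q : N ≤ x / 3
  N≤Q = subst (_≤ x / 3) (m*n/n≡m N 3) (/-monoˡ-≤ 3 packing-bound)
  N≢Q : N ≢ x / 3
  N≢Q N≡Q = no-near-perfect-packing (%12≡8⇒4∣ x x%12≡8) (begin
    2 + N * 3          ≡⟨ cong₂ (λ r q → r + q * 3) (sym (%12≡8⇒%3≡2 x x%12≡8)) N≡Q ⟩
    x % 3 + x / 3 * 3  ≡⟨ m≡m%n+[m/n]*n x 3 ⟨
    x                  ∎)
    where open ≡-Reasoning
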